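{- Let $J=J(12,4)_{\{1,3\}}$. For any permutation $\phi$ of $\{1,\dots,12\}$, if an automorphism $\Psi$ of $J$ fixes every vertex in $S_1=\{V^{\phi}_j, V^{\phi\tau_i}_j : i,j=1,\dots,12\}$, then $\Psi$ also fixes $V^{\phi\tau_i\tau_k}_j$ for all $i,j,k\in\{1,\dots,12\}$.
   Context: $J(12,4)_{\{1,3\}}$ is the graph whose vertices are the 4-element subsets of $\{1,\dots,12\}$, with $M,N$ adjacent iff $|M\cap N|\in\{3,1\}$. For a permutation $\phi$ of $\{1,\dots,12\}$ and $\ell\in\{1,\dots,12\}$, $V^\phi_\ell=\{\phi(\ell),\phi(\ell+1),\phi(\ell+2),\phi(\ell+3)\}$, indices taken modulo 12. For $i=1,\dots,12$, $\tau_i$ is the transposition exchanging $i$ and $i+1$ (modulo 12). Products are compositions: $(\phi\tau)(x)=\phi(\tau(x))$. -}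

module Defs where

open import Data.Nat using (ℕ; suc; s≤s; _<?_)
open import Relation.Nullary using (yes; no)
open import Data.Fin using (Fin; zero; suc; toℕ; fromℕ<)
open import Data.Fin.Subset using (Subset; ∣_∣; _∩_; _∪_; ⁅_⁆)
open import Data.Fin.Permutation using (Permutation′; _⟨$⟩ʳ_; _∘ₚ_; transpose)
open import Data.Product using (Σ; proj₁; _×_)
open import Data.Sum using (_⊎_)
open import Relation.Binary.PropositionalEquality using (_≡_)
open import Function.Bundles using (_↔_; Inverse)

-- Ground set {1,…,12} is modelled as Fin 12 = {0,…,11} (element k ↦ k+1).
Ground : Set
Ground = Fin 12

Vertex : Set
Vertex = Σ (Subset 12) (λ M → ∣ M ∣ ≡ 4)

Adj : Vertex → Vertex → Set
Adj M N = (∣ proj₁ M ∩ proj₁ N ∣ ≡ 3) ⊎ (∣ proj₁ M ∩ proj₁ N ∣ ≡ 1)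

record Automorphism : Set where
  field
    bij : Vertex ↔ Vertex
    adj : ∀ M N → (Adj M N → Adj (Inverse.to bij M) (Inverse.to bij N))
                × (Adj (Inverse.to bij M) (Inverse.to bij N) → Adj M N)

open Automorphism public

sucMod : Ground → Ground
sucMod i with toℕ i <? 11
... | yes p = fromℕ< (s≤s p)
... | no _ = zero

_⊕_ : Ground → ℕ → Ground
i ⊕ 0 = i
i ⊕ suc k = sucMod i ⊕ k

τ : Ground → Permutation′ 12
τ i = transpose i (sucMod i)

-- Product (composition) of permutations: (φ · ψ)(x) = φ(ψ(x))
_·_ : Permutation′ 12 → Permutation′ 12 → Permutation′ 12
φ · ψ = ψ ∘ₚ φ

V : Permutation′ 12 → Ground → Subset 12
V φ ℓ = ⁅ φ ⟨$⟩ʳ ℓ ⁆ ∪ ⁅ φ ⟨$⟩ʳ (ℓ ⊕ 1) ⁆ ∪ ⁅ φ ⟨$⟩ʳ (ℓ ⊕ 2) ⁆ ∪ ⁅ φ ⟨$⟩ʳ (ℓ ⊕ 3) ⁆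

Fixes : Automorphism → Subset 12 → Set
Fixes Ψ S = ∀ (M : Vertex) → proj₁ M ≡ S → proj₁ (Inverse.to (bij Ψ) M) ≡ S

-- Two 4-sets are adjacent exactly when they meet in an odd number of points, so an
-- automorphism Ψ fixing a vertex N preserves the parity of |M ∩ N| for every vertex M.
-- Hence D = Ψ(M) Δ M meets every vertex of S₁ evenly.  The windows V^φ_{ℓ+1} and
-- V^{φτ_ℓ}_{ℓ+1} differ only in that φ(ℓ+1) is replaced by φ(ℓ), so D contains φ(ℓ)
-- iff it contains φ(ℓ+1); walking around the cycle, D is empty or everything, and
-- |Ψ(M)| = 4 ≠ 8 = |∁ M| rules out the latter.  Thus Ψ fixes every vertex.

module Submission where

open import Defs
open import Data.Bool.Base using (Bool; true; false; not; _xor_; _∧_)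
open import Data.Bool.Properties
  using (not-distribˡ-xor; not-distribʳ-xor; not-involutive; xor-same; ∧-zeroʳ; ⇔→≡)
open import Data.Fin using (Fin; zero; suc; toℕ; #_; inject₁)
open import Data.Fin.Properties using (_≟_; all?; toℕ-inject₁)
open import Data.Fin.Permutation using (Permutation′; _⟨$⟩ʳ_; _⟨$⟩ˡ_; inverseʳ; transpose)
open import Data.Fin.Subset using (Subset; ∣_∣; _∩_; _∪_; ⁅_⁆; ⊥; ⊤; ∁)
open import Data.Fin.Subset.Properties
  using (∣⊥∣≡0; ∩-zeroˡ; ∩-zeroʳ; ∩-distribˡ-∪; ∪-identityˡ; ∩-identityˡ; ∣⁅x⁆∣≡1; ∣p∩q∣≤∣p∣; ∣∁p∣≡n∸∣p∣)
open import Data.Nat.Base using (ℕ; zero; suc; _+_; _∸_; _≤_; s≤s)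
open import Data.Nat.Properties using (+-comm; +-suc)
open import Data.Product.Base using (proj₁; proj₂; _,_)
open import Data.Sum.Base using (_⊎_; inj₁; inj₂)
open import Data.Vec.Base using ([]; _∷_; lookup; zipWith; replicate)
open import Data.Vec.Properties using (∷-injectiveˡ; ∷-injectiveʳ; tabulate∘lookup; tabulate-cong)
open import Function.Base using (_∘_)
open import Function.Bundles using (Inverse; Injection; _⇔_; mk⇔)
open import Function.Properties.Inverse using (↔⇒↣)
open import Function.Properties.Equivalence using () renaming (sym to ⇔-sym; trans to ⇔-trans)
open import Relation.Binary.PropositionalEquality
  using (_≡_; _≢_; ≢-sym; refl; sym; trans; cong; cong₂; subst; module ≡-Reasoning)
open import Relation.Nullary.Decidable using (toWitness; ¬?; dec-true; dec-false; yes; no)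
open import Relation.Nullary.Negation using (contradiction)

⊕-+ : ∀ ℓ m n → ℓ ⊕ (m + n) ≡ (ℓ ⊕ m) ⊕ n
⊕-+ ℓ zero    n = refl
⊕-+ ℓ (suc m) n = ⊕-+ (sucMod ℓ) m n

ℓ⊕1+k≢ℓ : ∀ ℓ (k : Fin 11) → ℓ ⊕ suc (toℕ k) ≢ ℓ
ℓ⊕1+k≢ℓ = toWitness {a? = all? λ ℓ → all? λ k → ¬? (ℓ ⊕ suc (toℕ k) ≟ ℓ)} _

0⊕toℕ : ∀ i → zero ⊕ toℕ i ≡ i
0⊕toℕ = toWitness {a? = all? λ i → zero ⊕ toℕ i ≟ i} _

⊕1-invariant⇒constant : {A : Set} (f : Ground → A) →
  (∀ ℓ → f ℓ ≡ f (ℓ ⊕ 1)) → ∀ i → f i ≡ f zero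
⊕1-invariant⇒constant f f-inv i = trans (cong f (sym (0⊕toℕ i))) (from-zero (toℕ i))
  where
  from-zero : ∀ m → f (zero ⊕ m) ≡ f zero
  from-zero zero    = refl
  from-zero (suc m) = begin
    f (zero ⊕ suc m)     ≡⟨ cong (λ n → f (zero ⊕ n)) (+-comm 1 m) ⟩
    f (zero ⊕ (m + 1))   ≡⟨ cong f (⊕-+ zero m 1) ⟩
    f ((zero ⊕ m) ⊕ 1)   ≡⟨ sym (f-inv (zero ⊕ m)) ⟩
    f (zero ⊕ m)         ≡⟨ from-zero m ⟩
    f zero               ∎
    where open ≡-Reasoning

transpose⟨$⟩ʳj≡i : ∀ {n} (i j : Fin n) → transpose i j ⟨$⟩ʳ j ≡ i
transpose⟨$⟩ʳj≡i i j with j ≟ i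
... | yes j≡i = j≡i
... | no  _   rewrite dec-true (j ≟ j) refl = refl

transpose⟨$⟩ʳk≡k : ∀ {n} {i j k : Fin n} → k ≢ i → k ≢ j → transpose i j ⟨$⟩ʳ k ≡ k
transpose⟨$⟩ʳk≡k {i = i} {j} {k} k≢i k≢j rewrite dec-false (k ≟ i) k≢i | dec-false (k ≟ j) k≢j = refl

τ-moves : ∀ ℓ → τ ℓ ⟨$⟩ʳ (ℓ ⊕ 1) ≡ ℓ
τ-moves ℓ = transpose⟨$⟩ʳj≡i ℓ (ℓ ⊕ 1)

τ-fixes : ∀ ℓ (k : Fin 10) → τ ℓ ⟨$⟩ʳ (ℓ ⊕ (2 + toℕ k)) ≡ ℓ ⊕ (2 + toℕ k)
τ-fixes ℓ k = transpose⟨$⟩ʳk≡k (ℓ⊕1+k≢ℓ ℓ (suc k))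
  (subst (λ m → (ℓ ⊕ 1) ⊕ suc m ≢ ℓ ⊕ 1) (toℕ-inject₁ k) (ℓ⊕1+k≢ℓ (ℓ ⊕ 1) (inject₁ k)))

⟨$⟩ʳ-≢ : ∀ {n} (σ : Permutation′ n) {x y} → x ≢ y → σ ⟨$⟩ʳ x ≢ σ ⟨$⟩ʳ y
⟨$⟩ʳ-≢ σ x≢y = x≢y ∘ Injection.injective (↔⇒↣ σ)

odd : ℕ → Bool
odd zero    = false
odd (suc n) = not (odd n)

odd-+ : ∀ m n → odd (m + n) ≡ odd m xor odd n
odd-+ zero    n = refl
odd-+ (suc m) n = trans (cong not (odd-+ m n)) (not-distribˡ-xor (odd m) (odd n))

∈｛1,3｝⇔odd : ∀ n → n ≤ 4 → ((n ≡ 3) ⊎ (n ≡ 1)) ⇔ (odd n ≡ true)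
∈｛1,3｝⇔odd 0 _ = mk⇔ (λ { (inj₁ ()) ; (inj₂ ()) }) (λ ())
∈｛1,3｝⇔odd 1 _ = mk⇔ (λ _ → refl) (λ _ → inj₂ refl)
∈｛1,3｝⇔odd 2 _ = mk⇔ (λ { (inj₁ ()) ; (inj₂ ()) }) (λ ())
∈｛1,3｝⇔odd 3 _ = mk⇔ (λ _ → refl) (λ _ → inj₁ refl)
∈｛1,3｝⇔odd 4 _ = mk⇔ (λ { (inj₁ ()) ; (inj₂ ()) }) (λ ())
∈｛1,3｝⇔odd (suc (suc (suc (suc (suc _))))) (s≤s (s≤s (s≤s (s≤s ()))))

xor≡false⇒≡ : ∀ {a b} → a xor b ≡ false → a ≡ b
xor≡false⇒≡ {true}  {true}  _ = refl
xor≡false⇒≡ {false} {false} _ = refl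

xor≡true⇒≡not : ∀ {a b} → a xor b ≡ true → a ≡ not b
xor≡true⇒≡not {true}  {false} _ = refl
xor≡true⇒≡not {false} {true}  _ = refl

not-xor-not : ∀ a b → not a xor not b ≡ a xor b
not-xor-not a b = begin
  not a xor not b       ≡⟨ sym (not-distribˡ-xor a (not b)) ⟩
  not (a xor not b)     ≡⟨ cong not (sym (not-distribʳ-xor a b)) ⟩
  not (not (a xor b))   ≡⟨ not-involutive (a xor b) ⟩
  a xor b               ∎
  where open ≡-Reasoning

infixl 6 _Δ_

_Δ_ : ∀ {n} → Subset n → Subset n → Subset n
p Δ q = zipWith _xor_ p q

odd-∣Δ∩∣ : ∀ {n} (p q r : Subset n) → odd ∣ (p Δ q) ∩ r ∣ ≡ odd ∣ p ∩ r ∣ xor odd ∣ q ∩ r ∣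
odd-∣Δ∩∣ []      []      []          = refl
odd-∣Δ∩∣ (x ∷ p) (y ∷ q) (false ∷ r)
  rewrite ∧-zeroʳ (x xor y) | ∧-zeroʳ x | ∧-zeroʳ y = odd-∣Δ∩∣ p q r
odd-∣Δ∩∣ (true  ∷ p) (true  ∷ q) (true ∷ r) =
  trans (odd-∣Δ∩∣ p q r) (sym (not-xor-not (odd ∣ p ∩ r ∣) (odd ∣ q ∩ r ∣)))
odd-∣Δ∩∣ (true  ∷ p) (false ∷ q) (true ∷ r) =
  trans (cong not (odd-∣Δ∩∣ p q r)) (not-distribˡ-xor (odd ∣ p ∩ r ∣) (odd ∣ q ∩ r ∣))
odd-∣Δ∩∣ (false ∷ p) (true  ∷ q) (true ∷ r) =
  trans (cong not (odd-∣Δ∩∣ p q r)) (not-distribʳ-xor (odd ∣ p ∩ r ∣) (odd ∣ q ∩ r ∣))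
odd-∣Δ∩∣ (false ∷ p) (false ∷ q) (true ∷ r) = odd-∣Δ∩∣ p q r

Δ≡⊥⇒≡ : ∀ {n} (p q : Subset n) → p Δ q ≡ ⊥ → p ≡ q
Δ≡⊥⇒≡ []      []      _  = refl
Δ≡⊥⇒≡ (x ∷ p) (y ∷ q) eq = cong₂ _∷_ (xor≡false⇒≡ (∷-injectiveˡ eq)) (Δ≡⊥⇒≡ p q (∷-injectiveʳ eq))

Δ≡⊤⇒≡∁ : ∀ {n} (p q : Subset n) → p Δ q ≡ ⊤ → p ≡ ∁ q
Δ≡⊤⇒≡∁ []      []      _  = refl
Δ≡⊤⇒≡∁ (x ∷ p) (y ∷ q) eq = cong₂ _∷_ (xor≡true⇒≡not (∷-injectiveˡ eq)) (Δ≡⊤⇒≡∁ p q (∷-injectiveʳ eq))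

∣p∩⊥∣≡0 : ∀ {n} (p : Subset n) → ∣ p ∩ ⊥ ∣ ≡ 0
∣p∩⊥∣≡0 {n} p = trans (cong ∣_∣ (∩-zeroʳ p)) (∣⊥∣≡0 n)

odd∣p∩⁅x⁆∣ : ∀ {n} (p : Subset n) x → odd ∣ p ∩ ⁅ x ⁆ ∣ ≡ lookup p x
odd∣p∩⁅x⁆∣ {suc n} (true  ∷ p) zero    = cong (λ m → not (odd m)) (∣p∩⊥∣≡0 p)
odd∣p∩⁅x⁆∣ {suc n} (false ∷ p) zero    = cong odd (∣p∩⊥∣≡0 p)
odd∣p∩⁅x⁆∣         (b     ∷ p) (suc x) rewrite ∧-zeroʳ b = odd∣p∩⁅x⁆∣ p x

⁅x⁆∩⁅y⁆≡⊥ : ∀ {n} {x y : Fin n} → x ≢ y → ⁅ x ⁆ ∩ ⁅ y ⁆ ≡ ⊥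
⁅x⁆∩⁅y⁆≡⊥ {x = zero}  {zero}  x≢y = contradiction refl x≢y
⁅x⁆∩⁅y⁆≡⊥ {x = zero}  {suc y} _   = cong (false ∷_) (∩-zeroˡ ⁅ y ⁆)
⁅x⁆∩⁅y⁆≡⊥ {x = suc x} {zero}  _   = cong (false ∷_) (∩-zeroʳ ⁅ x ⁆)
⁅x⁆∩⁅y⁆≡⊥ {x = suc x} {suc y} x≢y = cong (false ∷_) (⁅x⁆∩⁅y⁆≡⊥ (x≢y ∘ cong suc))

∩-∪-disjoint : ∀ {n} (p q r : Subset n) → p ∩ q ≡ ⊥ → p ∩ r ≡ ⊥ → p ∩ (q ∪ r) ≡ ⊥
∩-∪-disjoint p q r p∩q≡⊥ p∩r≡⊥ = begin
  p ∩ (q ∪ r)          ≡⟨ ∩-distribˡ-∪ p q r ⟩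
  p ∩ q ∪ p ∩ r        ≡⟨ cong₂ _∪_ p∩q≡⊥ p∩r≡⊥ ⟩
  ⊥ ∪ ⊥                ≡⟨ ∪-identityˡ ⊥ ⟩
  ⊥                    ∎
  where open ≡-Reasoning

∣p∩[q∪r]∣ : ∀ {n} (p q r : Subset n) → q ∩ r ≡ ⊥ → ∣ p ∩ (q ∪ r) ∣ ≡ ∣ p ∩ q ∣ + ∣ p ∩ r ∣
∣p∩[q∪r]∣ []          []          []          _  = refl
∣p∩[q∪r]∣ (false ∷ p) (_     ∷ q) (_     ∷ r) eq = ∣p∩[q∪r]∣ p q r (∷-injectiveʳ eq)
∣p∩[q∪r]∣ (true  ∷ p) (false ∷ q) (false ∷ r) eq = ∣p∩[q∪r]∣ p q r (∷-injectiveʳ eq)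
∣p∩[q∪r]∣ (true  ∷ p) (true  ∷ q) (false ∷ r) eq = cong suc (∣p∩[q∪r]∣ p q r (∷-injectiveʳ eq))
∣p∩[q∪r]∣ (true  ∷ p) (false ∷ q) (true  ∷ r) eq =
  trans (cong suc (∣p∩[q∪r]∣ p q r (∷-injectiveʳ eq))) (sym (+-suc ∣ p ∩ q ∣ ∣ p ∩ r ∣))
∣p∩[q∪r]∣ (true  ∷ p) (true  ∷ q) (true  ∷ r) eq = contradiction (∷-injectiveˡ eq) λ ()

quad : ∀ {n} → Fin n → Fin n → Fin n → Fin n → Subset n
quad a b c d = ⁅ a ⁆ ∪ ⁅ b ⁆ ∪ ⁅ c ⁆ ∪ ⁅ d ⁆

record Distinct₄ {n} (a b c d : Fin n) : Set where
  field
    a≢b : a ≢ b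
    a≢c : a ≢ c
    a≢d : a ≢ d
    b≢c : b ≢ c
    b≢d : b ≢ d
    c≢d : c ≢ d

module _ {n} {a b c d : Fin n} (distinct : Distinct₄ a b c d) where
  open Distinct₄ distinct

  ∣p∩quad∣ : ∀ p → ∣ p ∩ quad a b c d ∣ ≡ ∣ p ∩ ⁅ a ⁆ ∣ + (∣ p ∩ ⁅ b ⁆ ∣ + (∣ p ∩ ⁅ c ⁆ ∣ + ∣ p ∩ ⁅ d ⁆ ∣))
  ∣p∩quad∣ p = begin
    ∣ p ∩ (⁅ a ⁆ ∪ ⁅ b ⁆ ∪ ⁅ c ⁆ ∪ ⁅ d ⁆) ∣
      ≡⟨ ∣p∩[q∪r]∣ p _ _ (∩-∪-disjoint _ _ _ (⁅x⁆∩⁅y⁆≡⊥ a≢b) (∩-∪-disjoint _ _ _ (⁅x⁆∩⁅y⁆≡⊥ a≢c) (⁅x⁆∩⁅y⁆≡⊥ a≢d))) ⟩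
    ∣ p ∩ ⁅ a ⁆ ∣ + ∣ p ∩ (⁅ b ⁆ ∪ ⁅ c ⁆ ∪ ⁅ d ⁆) ∣
      ≡⟨ cong (∣ p ∩ ⁅ a ⁆ ∣ +_) (∣p∩[q∪r]∣ p _ _ (∩-∪-disjoint _ _ _ (⁅x⁆∩⁅y⁆≡⊥ b≢c) (⁅x⁆∩⁅y⁆≡⊥ b≢d))) ⟩
    ∣ p ∩ ⁅ a ⁆ ∣ + (∣ p ∩ ⁅ b ⁆ ∣ + ∣ p ∩ (⁅ c ⁆ ∪ ⁅ d ⁆) ∣)
      ≡⟨ cong (λ m → ∣ p ∩ ⁅ a ⁆ ∣ + (∣ p ∩ ⁅ b ⁆ ∣ + m)) (∣p∩[q∪r]∣ p _ _ (⁅x⁆∩⁅y⁆≡⊥ c≢d)) ⟩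
    ∣ p ∩ ⁅ a ⁆ ∣ + (∣ p ∩ ⁅ b ⁆ ∣ + (∣ p ∩ ⁅ c ⁆ ∣ + ∣ p ∩ ⁅ d ⁆ ∣))
      ∎
    where open ≡-Reasoning

  ∣quad∣≡4 : ∣ quad a b c d ∣ ≡ 4
  ∣quad∣≡4 = begin
    ∣ quad a b c d ∣       ≡⟨ cong ∣_∣ (sym (∩-identityˡ (quad a b c d))) ⟩
    ∣ ⊤ ∩ quad a b c d ∣   ≡⟨ ∣p∩quad∣ ⊤ ⟩
    ∣ ⊤ ∩ ⁅ a ⁆ ∣ + (∣ ⊤ ∩ ⁅ b ⁆ ∣ + (∣ ⊤ ∩ ⁅ c ⁆ ∣ + ∣ ⊤ ∩ ⁅ d ⁆ ∣))
      ≡⟨ cong₂ _+_ (∣⊤∩⁅x⁆∣ a) (cong₂ _+_ (∣⊤∩⁅x⁆∣ b) (cong₂ _+_ (∣⊤∩⁅x⁆∣ c) (∣⊤∩⁅x⁆∣ d))) ⟩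
    4                           ∎
    where
    open ≡-Reasoning
    ∣⊤∩⁅x⁆∣ : ∀ x → ∣ ⊤ ∩ ⁅ x ⁆ ∣ ≡ 1
    ∣⊤∩⁅x⁆∣ x = trans (cong ∣_∣ (∩-identityˡ ⁅ x ⁆)) (∣⁅x⁆∣≡1 x)

  odd∣p∩quad∣ : ∀ p → odd ∣ p ∩ quad a b c d ∣ ≡ lookup p a xor (lookup p b xor (lookup p c xor lookup p d))
  odd∣p∩quad∣ p = begin
    odd ∣ p ∩ quad a b c d ∣
      ≡⟨ cong odd (∣p∩quad∣ p) ⟩
    odd (∣ p ∩ ⁅ a ⁆ ∣ + (∣ p ∩ ⁅ b ⁆ ∣ + (∣ p ∩ ⁅ c ⁆ ∣ + ∣ p ∩ ⁅ d ⁆ ∣)))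
      ≡⟨ odd-∣p∩⁅x⁆∣+ a _ ⟩
    lookup p a xor odd (∣ p ∩ ⁅ b ⁆ ∣ + (∣ p ∩ ⁅ c ⁆ ∣ + ∣ p ∩ ⁅ d ⁆ ∣))
      ≡⟨ cong (lookup p a xor_) (odd-∣p∩⁅x⁆∣+ b _) ⟩
    lookup p a xor (lookup p b xor odd (∣ p ∩ ⁅ c ⁆ ∣ + ∣ p ∩ ⁅ d ⁆ ∣))
      ≡⟨ cong (λ x → lookup p a xor (lookup p b xor x)) (odd-∣p∩⁅x⁆∣+ c _) ⟩
    lookup p a xor (lookup p b xor (lookup p c xor odd ∣ p ∩ ⁅ d ⁆ ∣))
      ≡⟨ cong (λ x → lookup p a xor (lookup p b xor (lookup p c xor x))) (odd∣p∩⁅x⁆∣ p d) ⟩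
    lookup p a xor (lookup p b xor (lookup p c xor lookup p d))
      ∎
    where
    open ≡-Reasoning
    odd-∣p∩⁅x⁆∣+ : ∀ x m → odd (∣ p ∩ ⁅ x ⁆ ∣ + m) ≡ lookup p x xor odd m
    odd-∣p∩⁅x⁆∣+ x m = trans (odd-+ ∣ p ∩ ⁅ x ⁆ ∣ m) (cong (_xor odd m) (odd∣p∩⁅x⁆∣ p x))

window-distinct : ∀ σ ℓ → Distinct₄ (σ ⟨$⟩ʳ ℓ) (σ ⟨$⟩ʳ (ℓ ⊕ 1)) (σ ⟨$⟩ʳ (ℓ ⊕ 2)) (σ ⟨$⟩ʳ (ℓ ⊕ 3))
window-distinct σ ℓ = record
  { a≢b = shifted-≢ ℓ (# 0)
  ; a≢c = shifted-≢ ℓ (# 1)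
  ; a≢d = shifted-≢ ℓ (# 2)
  ; b≢c = shifted-≢ (ℓ ⊕ 1) (# 0)
  ; b≢d = shifted-≢ (ℓ ⊕ 1) (# 1)
  ; c≢d = shifted-≢ (ℓ ⊕ 2) (# 0)
  }
  where
  shifted-≢ : ∀ m k → σ ⟨$⟩ʳ m ≢ σ ⟨$⟩ʳ (m ⊕ suc (toℕ k))
  shifted-≢ m k = ⟨$⟩ʳ-≢ σ (≢-sym (ℓ⊕1+k≢ℓ m k))

window : Permutation′ 12 → Ground → Vertex
window σ ℓ = V σ ℓ , ∣quad∣≡4 (window-distinct σ ℓ)

Adj⇔odd-meet : ∀ M N → Adj M N ⇔ (odd ∣ proj₁ M ∩ proj₁ N ∣ ≡ true)
Adj⇔odd-meet (M , ∣M∣≡4) (N , _) =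
  ∈｛1,3｝⇔odd ∣ M ∩ N ∣ (subst (∣ M ∩ N ∣ ≤_) ∣M∣≡4 (∣p∩q∣≤∣p∣ M N))

apply : Automorphism → Vertex → Vertex
apply Ψ = Inverse.to (bij Ψ)

odd-meet-invariant : ∀ Ψ N → Fixes Ψ (proj₁ N) → ∀ M →
  odd ∣ proj₁ (apply Ψ M) ∩ proj₁ N ∣ ≡ odd ∣ proj₁ M ∩ proj₁ N ∣
odd-meet-invariant Ψ N fixed M = begin
  odd ∣ proj₁ (apply Ψ M) ∩ proj₁ N ∣
    ≡⟨ cong (λ S → odd ∣ proj₁ (apply Ψ M) ∩ S ∣) (sym (fixed N refl)) ⟩
  odd ∣ proj₁ (apply Ψ M) ∩ proj₁ (apply Ψ N) ∣
    ≡⟨ ⇔→≡ (⇔-trans (⇔-sym (Adj⇔odd-meet (apply Ψ M) (apply Ψ N))) (⇔-trans Adj-reflected (Adj⇔odd-meet M N))) ⟩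
  odd ∣ proj₁ M ∩ proj₁ N ∣
    ∎
  where
  open ≡-Reasoning
  Adj-reflected : Adj (apply Ψ M) (apply Ψ N) ⇔ Adj M N
  Adj-reflected = mk⇔ (proj₂ (adj Ψ M N)) (proj₁ (adj Ψ M N))

Δ-meets-fixed-evenly : ∀ Ψ N → Fixes Ψ (proj₁ N) → ∀ M →
  odd ∣ (proj₁ (apply Ψ M) Δ proj₁ M) ∩ proj₁ N ∣ ≡ false
Δ-meets-fixed-evenly Ψ N fixed M = begin
  odd ∣ (proj₁ (apply Ψ M) Δ proj₁ M) ∩ proj₁ N ∣
    ≡⟨ odd-∣Δ∩∣ (proj₁ (apply Ψ M)) (proj₁ M) (proj₁ N) ⟩
  odd ∣ proj₁ (apply Ψ M) ∩ proj₁ N ∣ xor odd ∣ proj₁ M ∩ proj₁ N ∣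
    ≡⟨ cong (_xor odd ∣ proj₁ M ∩ proj₁ N ∣) (odd-meet-invariant Ψ N fixed M) ⟩
  odd ∣ proj₁ M ∩ proj₁ N ∣ xor odd ∣ proj₁ M ∩ proj₁ N ∣
    ≡⟨ xor-same (odd ∣ proj₁ M ∩ proj₁ N ∣) ⟩
  false
    ∎
  where open ≡-Reasoning

meets-S₁-evenly⇒⊥⊎⊤ : ∀ φ (D : Subset 12) →
  (∀ j → odd ∣ D ∩ V φ j ∣ ≡ false) →
  (∀ i j → odd ∣ D ∩ V (φ · τ i) j ∣ ≡ false) →
  D ≡ ⊥ ⊎ D ≡ ⊤
meets-S₁-evenly⇒⊥⊎⊤ φ D even₀ even₁ = by-value (d zero) D≡replicate
  where
  open ≡-Reasoning

  d : Ground → Bool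
  d ℓ = lookup D (φ ⟨$⟩ʳ ℓ)

  rest : Ground → Bool
  rest ℓ = d (ℓ ⊕ 2) xor (d (ℓ ⊕ 3) xor d (ℓ ⊕ 4))

  window-φ : ∀ ℓ → d (ℓ ⊕ 1) xor rest ℓ ≡ false
  window-φ ℓ = trans (sym (odd∣p∩quad∣ (window-distinct φ (ℓ ⊕ 1)) D)) (even₀ (ℓ ⊕ 1))

  window-φτ : ∀ ℓ → d ℓ xor rest ℓ ≡ false
  window-φτ ℓ = begin
    d ℓ xor rest ℓ
      ≡⟨ cong₂ _xor_ (cong d (sym (τ-moves ℓ)))
           (cong₂ _xor_ (cong d (sym (τ-fixes ℓ (# 0))))
             (cong₂ _xor_ (cong d (sym (τ-fixes ℓ (# 1)))) (cong d (sym (τ-fixes ℓ (# 2)))))) ⟩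
    d (τ ℓ ⟨$⟩ʳ (ℓ ⊕ 1)) xor (d (τ ℓ ⟨$⟩ʳ (ℓ ⊕ 2)) xor (d (τ ℓ ⟨$⟩ʳ (ℓ ⊕ 3)) xor d (τ ℓ ⟨$⟩ʳ (ℓ ⊕ 4))))
      ≡⟨ sym (odd∣p∩quad∣ (window-distinct (φ · τ ℓ) (ℓ ⊕ 1)) D) ⟩
    odd ∣ D ∩ V (φ · τ ℓ) (ℓ ⊕ 1) ∣
      ≡⟨ even₁ ℓ (ℓ ⊕ 1) ⟩
    false
      ∎

  d-shift : ∀ ℓ → d ℓ ≡ d (ℓ ⊕ 1)
  d-shift ℓ = trans (xor≡false⇒≡ (window-φτ ℓ)) (sym (xor≡false⇒≡ (window-φ ℓ)))

  D-constant : ∀ z → lookup D z ≡ d zero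
  D-constant z = trans (cong (lookup D) (sym (inverseʳ φ))) (⊕1-invariant⇒constant d d-shift (φ ⟨$⟩ˡ z))

  D≡replicate : D ≡ replicate 12 (d zero)
  D≡replicate = trans (sym (tabulate∘lookup D)) (tabulate-cong D-constant)

  by-value : ∀ b → D ≡ replicate 12 b → D ≡ ⊥ ⊎ D ≡ ⊤
  by-value false = inj₁
  by-value true  = inj₂

Δ≡⊥⊎Δ≡⊤⇒≡ : ∀ (X Y : Vertex) → proj₁ Y Δ proj₁ X ≡ ⊥ ⊎ proj₁ Y Δ proj₁ X ≡ ⊤ → proj₁ Y ≡ proj₁ X
Δ≡⊥⊎Δ≡⊤⇒≡ X Y (inj₁ Δ≡⊥) = Δ≡⊥⇒≡ (proj₁ Y) (proj₁ X) Δ≡⊥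
Δ≡⊥⊎Δ≡⊤⇒≡ X Y (inj₂ Δ≡⊤) = contradiction 4≡8 λ ()
  where
  open ≡-Reasoning
  4≡8 : 4 ≡ 8
  4≡8 = begin
    4                  ≡⟨ sym (proj₂ Y) ⟩
    ∣ proj₁ Y ∣        ≡⟨ cong ∣_∣ (Δ≡⊤⇒≡∁ (proj₁ Y) (proj₁ X) Δ≡⊤) ⟩
    ∣ ∁ (proj₁ X) ∣    ≡⟨ ∣∁p∣≡n∸∣p∣ (proj₁ X) ⟩
    12 ∸ ∣ proj₁ X ∣   ≡⟨ cong (12 ∸_) (proj₂ X) ⟩
    8                  ∎

S₁-fixed⇒identity : ∀ φ Ψ →
  (∀ j → Fixes Ψ (V φ j)) →
  (∀ i j → Fixes Ψ (V (φ · τ i) j)) →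
  ∀ M → proj₁ (apply Ψ M) ≡ proj₁ M
S₁-fixed⇒identity φ Ψ fixed₀ fixed₁ M = Δ≡⊥⊎Δ≡⊤⇒≡ M (apply Ψ M)
  (meets-S₁-evenly⇒⊥⊎⊤ φ (proj₁ (apply Ψ M) Δ proj₁ M)
    (λ j → Δ-meets-fixed-evenly Ψ (window φ j) (fixed₀ j) M)
    (λ i j → Δ-meets-fixed-evenly Ψ (window (φ · τ i) j) (fixed₁ i j) M))

lemma3p5 : (φ : Permutation′ 12) (Ψ : Automorphism)
    → (∀ j → Fixes Ψ (V φ j))
    → (∀ i j → Fixes Ψ (V (φ · τ i) j))
    → ∀ i j k → Fixes Ψ (V ((φ · τ i) · τ k) j)
lemma3p5 φ Ψ fixed₀ fixed₁ i j k M M≡V = trans (S₁-fixed⇒identity φ Ψ fixed₀ fixed₁ M) M≡V
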